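{- For every odd positive integer $m$ and every positive integer $k$, the checkerboard graph $G_{m,4k+2}$ admits no graph derangement of cycle type $(6,4,\dots,4)$ (i.e., exactly one cycle of length $6$ and all other cycles of length $4$). Consequently these graphs are not even universal.
   Context: For positive integers $m,n$, $G_{m,n}$ denotes the checkerboard graph (also written $R_{m,n}$): vertex set $\{1,\dots,m\}\times\{1,\dots,n\}$, with $(x_1,x_2)$ adjacent to $(y_1,y_2)$ iff $|x_1-y_1|+|x_2-y_2|=1$. A graph derangement of a graph $G=(V,E)$ is an injective map $f:V\to V$ with $f(v)$ adjacent to $v$ for all $v$. For a finite graph, the cycles of $f$ are its orbits, and the cycle type of $f$ is the partition of $\#V$ given by the multiset of cycle sizes. A finite graph with $N$ vertices is even universal if every partition of $N$ into even parts is the cycle type of some graph derangement of it. -}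

module Defs where

open import Data.Nat using (ℕ; zero; suc; _+_; _*_; _∸_; _<_; ∣_-_∣; _≡ᵇ_)
open import Data.Nat.Divisibility using (_∣_)
open import Data.Fin using (Fin; toℕ)
open import Data.Fin.Properties using (_≟_)
open import Data.Product using (Σ; _×_; _,_; proj₁; proj₂)
open import Data.Bool using (Bool; true; false; _∧_; not; if_then_else_)
open import Data.List using (List; []; _∷_; map; concatMap; allFin; length; filter; upTo; foldr)
open import Data.Nat.ListAction using (sum)
open import Data.List.Relation.Unary.All using (All)
open import Relation.Nullary.Decidable using (⌊_⌋)
open import Relation.Binary.PropositionalEquality using (_≡_)
open import Function.Definitions using (Injective)

Vertex : ℕ → ℕ → Set
Vertex m n = Fin m × Fin n

Adj : ∀ {m n} → Vertex m n → Vertex m n → Set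
Adj (x₁ , x₂) (y₁ , y₂) = ∣ toℕ x₁ - toℕ y₁ ∣ + ∣ toℕ x₂ - toℕ y₂ ∣ ≡ 1

IsGraphDerangement : ∀ {m n} → (Vertex m n → Vertex m n) → Set
IsGraphDerangement f = Injective _≡_ _≡_ f × (∀ v → Adj v (f v))

vertices : ∀ m n → List (Vertex m n)
vertices m n = concatMap (λ i → map (λ j → (i , j)) (allFin n)) (allFin m)

_==_ : ∀ {m n} → Vertex m n → Vertex m n → Bool
(a₁ , a₂) == (b₁ , b₂) = ⌊ a₁ ≟ b₁ ⌋ ∧ ⌊ a₂ ≟ b₂ ⌋

iter : ∀ {A : Set} → (A → A) → ℕ → A → A
iter f zero x = x
iter f (suc p) x = f (iter f p x)

-- p is the size of the cycle (orbit) of f containing v, i.e. the least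
-- positive p with f^p(v) = v.
isCycleLength : ∀ {m n} → (Vertex m n → Vertex m n) → Vertex m n → ℕ → Bool
isCycleLength f v zero = false
isCycleLength f v (suc p) =
  (iter f (suc p) v == v) ∧
  foldr (λ q b → not (iter f (suc q) v == v) ∧ b) true (upTo p)

verticesOnCyclesOfLength : ∀ {m n} → (Vertex m n → Vertex m n) → ℕ → ℕ
verticesOnCyclesOfLength {m} {n} f ℓ =
  length (filter (λ v → Data.Bool._≟_ (isCycleLength f v ℓ) true) (vertices m n))

mult : ℕ → List ℕ → ℕ
mult ℓ [] = 0
mult ℓ (x ∷ xs) = (if ℓ ≡ᵇ x then 1 else 0) + mult ℓ xs

-- f has cycle type λ (a partition given as a list; order irrelevant):
-- for every ℓ, the number of cycles of length ℓ equals the multiplicity of ℓ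
-- in λ, i.e. the vertices on ℓ-cycles number ℓ * mult ℓ λ.
HasCycleType : ∀ {m n} → (Vertex m n → Vertex m n) → List ℕ → Set
HasCycleType f λs = ∀ ℓ → verticesOnCyclesOfLength f ℓ ≡ ℓ * mult ℓ λs

EvenUniversal : ℕ → ℕ → Set
EvenUniversal m n =
  (λs : List ℕ) → All (λ p → (0 < p) × (2 ∣ p)) λs → sum λs ≡ m * n →
  Σ (Vertex m n → Vertex m n) (λ f → IsGraphDerangement f × HasCycleType f λs)

module Submission where

open import Defs
open import Data.Nat using (ℕ; NonZero; _≡ᵇ_; s≤s; z≤n; zero; suc; _+_; _*_; _∸_; _/_; _<_; _≤_; ∣_-_∣)
open import Data.Nat.Properties
  using ( +-comm; +-identityʳ; +-suc; +-cancelˡ-≡; *-comm; *-suc; m+n∸n≡m; suc-injective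
        ; 0≢1+n; m+1+n≢0; m≢1+n+m; ∣m-n∣≡0⇒m≡n; ≡⇒≡ᵇ
        ; ≤-reflexive; ≤-trans; <-irrefl; <-trans; 1+n≰n; m<n⇒m<1+n; n<1+n; +-monoˡ-≤; *-monoʳ-≤ )
open import Data.Nat.DivMod using (m*n/n≡m; _mod_; _divMod_; DivMod)
open import Data.Nat.ListAction using (sum)
open import Data.Nat.Tactic.RingSolver using (solve-∀)
open import Data.Nat.Divisibility using (divides; _∣_; _∣0; ∣-refl; ∣m∣n⇒∣m+n)
open import Data.Fin using (Fin; zero; suc; toℕ; fromℕ; fromℕ<)
open import Data.Fin.Properties
  using (_≟_; toℕ-injective; toℕ-fromℕ; toℕ-fromℕ<; toℕ<n; injective⇒≤; any?; ¬∀⟶∃¬)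
open import Data.Product using (Σ; ∃-syntax; _×_; _,_; proj₁; proj₂; swap)
open import Data.Sum using (_⊎_; inj₁; inj₂)
import Data.Sum as Sum
open import Data.Bool using (true; _∧_; not)
import Data.Bool as Bool
open import Data.List
  using (List; []; _∷_; replicate; upTo; foldr; length; lookup; map; concatMap; allFin; filter)
open import Data.List.Properties using (length-++; length-map; length-tabulate)
open import Data.List.Membership.Propositional.Properties using (∈-concat⁺′; ∈-map⁺; ∈-allFin; ∈-filter⁺)
open import Data.List.Membership.Propositional using (_∈_)
open import Data.List.Relation.Unary.Any using (index)
open import Data.List.Relation.Unary.Any.Properties using (lookup-index)
open import Data.List.Relation.Unary.All using (All; []; _∷_)
open import Data.List.Relation.Unary.All.Properties using (replicate⁺)
import Data.List.Relation.Unary.All as All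
open import Data.Empty using (⊥; ⊥-elim)
open import Function using (id; _∘_; case_of_)
open import Function.Definitions using (Injective)
open import Relation.Nullary using (¬_; yes; no; ¬?)
open import Relation.Unary using (Decidable)
open import Relation.Binary.PropositionalEquality
  using (_≡_; _≢_; refl; sym; trans; cong; cong₂; subst; module ≡-Reasoning)
open ≡-Reasoning

-- A 4-cycle of the grid is a unit square, so each vertex on a 4-cycle has exactly one cycle
-- neighbour in its own column.  In a column consisting only of such vertices this pairs up
-- the m cells of the column, matching each with an adjacent one: a perfect matching of a path
-- on an odd number of vertices, which does not exist.  So each of the n ≥ 6 columns meets the
-- hexagon.  But the hexagon cannot move only horizontally (its columns would be a closed
-- non-backtracking walk on ℕ), so two of its six vertices share a column, and it meets at
-- most five columns.

OneApart : ℕ → ℕ → Set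
OneApart x y = x ≡ suc y ⊎ y ≡ suc x

OneApart-sym : ∀ {x y} → OneApart x y → OneApart y x
OneApart-sym = Sum.swap

OneApart-irrefl : ∀ {x} → ¬ OneApart x x
OneApart-irrefl (inj₁ ())
OneApart-irrefl (inj₂ ())

∣m-n∣≡1⇒OneApart : ∀ x y → ∣ x - y ∣ ≡ 1 → OneApart x y
∣m-n∣≡1⇒OneApart zero       (suc zero) refl = inj₂ refl
∣m-n∣≡1⇒OneApart (suc zero) zero       refl = inj₁ refl
∣m-n∣≡1⇒OneApart (suc x)    (suc y)    eq   = Sum.map (cong suc) (cong suc) (∣m-n∣≡1⇒OneApart x y eq)

OneApart-between : ∀ {x₀ x₁ x₂ t} → OneApart x₀ x₁ → OneApart x₁ x₂ → x₂ ≢ x₀ →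
                   OneApart t x₀ → OneApart t x₂ → t ≡ x₁
OneApart-between (inj₁ refl) (inj₂ refl) x₂≢x₀ _ _ = ⊥-elim (x₂≢x₀ refl)
OneApart-between (inj₂ refl) (inj₁ refl) x₂≢x₀ _ _ = ⊥-elim (x₂≢x₀ refl)
OneApart-between (inj₁ refl) (inj₁ refl) _ (inj₂ refl) (inj₁ refl) = refl
OneApart-between (inj₁ refl) (inj₁ refl) _ (inj₁ ()) (inj₁ refl)
OneApart-between (inj₁ refl) (inj₁ refl) _ (inj₁ ()) (inj₂ refl)
OneApart-between (inj₁ refl) (inj₁ refl) _ (inj₂ refl) (inj₂ ())
OneApart-between (inj₂ refl) (inj₂ refl) _ (inj₁ refl) (inj₂ refl) = refl
OneApart-between (inj₂ refl) (inj₂ refl) _ (inj₁ refl) (inj₁ ())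
OneApart-between (inj₂ refl) (inj₂ refl) _ (inj₂ refl) (inj₁ ())
OneApart-between (inj₂ refl) (inj₂ refl) _ (inj₂ refl) (inj₂ ())

Point : Set
Point = ℕ × ℕ

HStep VStep LatticeAdj : Point → Point → Set
HStep (r , c) (r′ , c′) = r ≡ r′ × OneApart c c′
VStep (r , c) (r′ , c′) = c ≡ c′ × OneApart r r′
LatticeAdj p q = HStep p q ⊎ VStep p q

-- Transposing the lattice exchanges horizontal and vertical steps definitionally.
LatticeAdj-transpose : ∀ {p q} → LatticeAdj p q → LatticeAdj (swap p) (swap q)
LatticeAdj-transpose = Sum.swap

LatticeAdj-sym : ∀ {p q} → LatticeAdj p q → LatticeAdj q p
LatticeAdj-sym (inj₁ (refl , d)) = inj₁ (refl , OneApart-sym d)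
LatticeAdj-sym (inj₂ (refl , d)) = inj₂ (refl , OneApart-sym d)

LatticeAdj-irrefl : ∀ {p} → ¬ LatticeAdj p p
LatticeAdj-irrefl (inj₁ (_ , d)) = OneApart-irrefl d
LatticeAdj-irrefl (inj₂ (_ , d)) = OneApart-irrefl d

VStep-sym : ∀ {p q} → VStep p q → VStep q p
VStep-sym (refl , d) = refl , OneApart-sym d

HStep⇒col≢ : ∀ {p q} → HStep p q → proj₂ p ≢ proj₂ q
HStep⇒col≢ (_ , d) refl = OneApart-irrefl d

LatticeAdj⇒VStep : ∀ {p q} → LatticeAdj p q → proj₂ p ≡ proj₂ q → VStep p q
LatticeAdj⇒VStep (inj₁ h) eq = ⊥-elim (HStep⇒col≢ h eq)
LatticeAdj⇒VStep (inj₂ v) _  = v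

LatticeAdj⇒HStep : ∀ {p q} → LatticeAdj p q → proj₂ p ≢ proj₂ q → HStep p q
LatticeAdj⇒HStep (inj₁ h)       _   = h
LatticeAdj⇒HStep (inj₂ (eq , _)) neq = ⊥-elim (neq eq)

∣-∣+∣-∣≡1⇒LatticeAdj : ∀ r c r′ c′ → ∣ r - r′ ∣ + ∣ c - c′ ∣ ≡ 1 → LatticeAdj (r , c) (r′ , c′)
∣-∣+∣-∣≡1⇒LatticeAdj r c r′ c′ eq with ∣ r - r′ ∣ in eqᵣ | ∣ c - c′ ∣ in eq꜀
... | zero  | _     = inj₁ (∣m-n∣≡0⇒m≡n eqᵣ , ∣m-n∣≡1⇒OneApart c c′ (trans eq꜀ eq))
... | suc d | zero  = inj₂ (∣m-n∣≡0⇒m≡n eq꜀ ,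
                            ∣m-n∣≡1⇒OneApart r r′ (trans eqᵣ (trans (sym (+-identityʳ (suc d))) eq)))
... | suc d | suc _ = ⊥-elim (m+1+n≢0 d (suc-injective eq))

VStep-straight-commonNeighbour : ∀ {a b c d} → VStep a b → VStep b c → c ≢ a →
                                 LatticeAdj d a → LatticeAdj d c → d ≡ b
VStep-straight-commonNeighbour (refl , _) (refl , _) c≢a (inj₁ (refl , _)) (inj₁ (refl , _)) =
  ⊥-elim (c≢a refl)
VStep-straight-commonNeighbour (refl , _) (refl , _) _ (inj₁ (_ , da)) (inj₂ (refl , _)) =
  ⊥-elim (OneApart-irrefl da)
VStep-straight-commonNeighbour (refl , _) (refl , _) _ (inj₂ (refl , _)) (inj₁ (_ , dc)) =
  ⊥-elim (OneApart-irrefl dc)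
VStep-straight-commonNeighbour (refl , ab) (refl , bc) c≢a (inj₂ (refl , da)) (inj₂ (refl , dc)) =
  cong (_, _) (OneApart-between ab bc (c≢a ∘ cong (_, _)) da dc)

record Lattice4Cycle (a b c d : Point) : Set where
  field
    ab : LatticeAdj a b
    bc : LatticeAdj b c
    cd : LatticeAdj c d
    da : LatticeAdj d a
    c≢a : c ≢ a
    d≢b : d ≢ b

rotate : ∀ {a b c d} → Lattice4Cycle a b c d → Lattice4Cycle b c d a
rotate q = record { ab = bc ; bc = cd ; cd = da ; da = ab ; c≢a = d≢b ; d≢b = c≢a ∘ sym }
  where open Lattice4Cycle q

transpose : ∀ {a b c d} → Lattice4Cycle a b c d → Lattice4Cycle (swap a) (swap b) (swap c) (swap d)
transpose q = record
  { ab = LatticeAdj-transpose ab ; bc = LatticeAdj-transpose bc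
  ; cd = LatticeAdj-transpose cd ; da = LatticeAdj-transpose da
  ; c≢a = c≢a ∘ cong swap ; d≢b = d≢b ∘ cong swap }
  where open Lattice4Cycle q

-- A lattice 4-cycle is a unit square.
VStep⇒HStep-next : ∀ {a b c d} → Lattice4Cycle a b c d → VStep a b → HStep b c
VStep⇒HStep-next q vab with Lattice4Cycle.bc q
... | inj₁ hbc = hbc
... | inj₂ vbc = ⊥-elim (d≢b (VStep-straight-commonNeighbour vab vbc c≢a da (LatticeAdj-sym cd)))
  where open Lattice4Cycle q

HStep⇒VStep-next : ∀ {a b c d} → Lattice4Cycle a b c d → HStep a b → VStep b c
HStep⇒VStep-next q = VStep⇒HStep-next (transpose q)

module NonBacktrackingWalk (c : ℕ → ℕ) (step : ∀ j → OneApart (c j) (c (suc j)))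
                           (noBacktrack : ∀ j → c (suc (suc j)) ≢ c j) where

  ascending : c 1 ≡ suc (c 0) → ∀ j → c (suc j) ≡ suc (c j)
  ascending up zero = up
  ascending up (suc j) with step (suc j)
  ... | inj₁ down = ⊥-elim (noBacktrack j (suc-injective (trans (sym down) (ascending up j))))
  ... | inj₂ up′  = up′

  descending : c 0 ≡ suc (c 1) → ∀ j → c j ≡ suc (c (suc j))
  descending down zero = down
  descending down (suc j) with step (suc j)
  ... | inj₁ down′ = down′
  ... | inj₂ up    = ⊥-elim (noBacktrack j (trans up (sym (descending down j))))

  noReturn : ∀ p → c (suc p) ≢ c 0
  noReturn p ret with step 0
  ... | inj₁ down = <-irrefl ret (below p)
    where
    below : ∀ j → c (suc j) < c 0
    below zero    = ≤-reflexive (sym down)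
    below (suc j) = <-trans (≤-reflexive (sym (descending down (suc j)))) (below j)
  ... | inj₂ up = <-irrefl (sym ret) (above p)
    where
    above : ∀ j → c 0 < c (suc j)
    above zero    = ≤-reflexive (sym up)
    above (suc j) = <-trans (above j) (≤-reflexive (sym (ascending up (suc j))))

odd⇒≡1+2* : ∀ {m} → ¬ 2 ∣ m → ∃[ t ] m ≡ suc (2 * t)
odd⇒≡1+2* {zero}        odd = ⊥-elim (odd (2 ∣0))
odd⇒≡1+2* {suc zero}    _   = 0 , refl
odd⇒≡1+2* {suc (suc m)} odd with odd⇒≡1+2* {m} (odd ∘ ∣m∣n⇒∣m+n (∣-refl {2}))
... | t , refl = suc t , cong suc (sym (*-suc 2 t))

-- Inductively the vertex 2j is matched with 2j + 1, leaving the last vertex 2t unmatched.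
oddPath-noPerfectMatching : ∀ {m} → ¬ 2 ∣ m → (h : Fin m → Fin m) →
                            (∀ i → OneApart (toℕ (h i)) (toℕ i)) → (∀ i → h (h i) ≡ i) → ⊥
oddPath-noPerfectMatching odd h apart involutive with odd⇒≡1+2* odd
... | t , refl =
  <-irrefl (trans (matchedUpwards t last (toℕ-fromℕ _)) (cong suc (toℕ-fromℕ _))) (toℕ<n (h last))
  where
  last : Fin (suc (2 * t))
  last = fromℕ (2 * t)

  matchedUpwards : ∀ j i → toℕ i ≡ 2 * j → toℕ (h i) ≡ suc (toℕ i)
  matchedUpwards j i i≡2j with apart i
  matchedUpwards j       i _    | inj₁ up   = up
  matchedUpwards zero    i i≡0  | inj₂ down = ⊥-elim (0≢1+n (trans (sym i≡0) down))
  matchedUpwards (suc j) i i≡2j | inj₂ down =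
    ⊥-elim (m≢1+n+m (2 * j) {1} (trans (sym (toℕ-fromℕ< _)) (trans (cong toℕ i′≡i) i≡2+2j)))
    where
    i≡2+2j : toℕ i ≡ suc (suc (2 * j))
    i≡2+2j = trans i≡2j (*-suc 2 j)

    i′ : Fin (suc (2 * t))
    i′ = fromℕ< (<-trans (m<n⇒m<1+n (n<1+n (2 * j))) (subst (_< _) i≡2+2j (toℕ<n i)))

    hi′≡hi : h i′ ≡ h i
    hi′≡hi = toℕ-injective (begin
      toℕ (h i′)      ≡⟨ matchedUpwards j i′ (toℕ-fromℕ< _) ⟩
      suc (toℕ i′)    ≡⟨ cong suc (toℕ-fromℕ< _) ⟩
      suc (2 * j)     ≡⟨ suc-injective (trans (sym i≡2+2j) down) ⟩
      toℕ (h i)       ∎)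

    i′≡i : i′ ≡ i
    i′≡i = trans (sym (involutive i′)) (trans (cong h hi′≡hi) (involutive i))

module _ {A : Set} (f : A → A) where

  iter-+ : ∀ a b x → iter f (a + b) x ≡ iter f a (iter f b x)
  iter-+ zero    b x = refl
  iter-+ (suc a) b x = cong f (iter-+ a b x)

  iter-comm : ∀ a b x → iter f a (iter f b x) ≡ iter f b (iter f a x)
  iter-comm a b x = begin
    iter f a (iter f b x) ≡⟨ iter-+ a b x ⟨
    iter f (a + b) x      ≡⟨ cong (λ k → iter f k x) (+-comm a b) ⟩
    iter f (b + a) x      ≡⟨ iter-+ b a x ⟩
    iter f b (iter f a x) ∎

  iter-periodic : ∀ {p x} → iter f p x ≡ x → ∀ q → iter f (q * p) x ≡ x
  iter-periodic         fix zero    = refl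
  iter-periodic {p} {x} fix (suc q) =
    trans (iter-+ p (q * p) x) (trans (cong (iter f p) (iter-periodic fix q)) fix)

  iter-mod : ∀ {p x} .{{_ : NonZero p}} → iter f p x ≡ x → ∀ j → iter f j x ≡ iter f (toℕ (j mod p)) x
  iter-mod {p} {x} fix j = begin
    iter f j x                                    ≡⟨ cong (λ k → iter f k x) (DivMod.property (j divMod p)) ⟩
    iter f (toℕ (j mod p) + j / p * p) x          ≡⟨ iter-+ (toℕ (j mod p)) (j / p * p) x ⟩
    iter f (toℕ (j mod p)) (iter f (j / p * p) x) ≡⟨ cong (iter f (toℕ (j mod p))) (iter-periodic fix (j / p)) ⟩
    iter f (toℕ (j mod p)) x                      ∎

  module _ (f-injective : Injective _≡_ _≡_ f) where

    iter-injective : ∀ j {x y} → iter f j x ≡ iter f j y → x ≡ y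
    iter-injective zero    eq = eq
    iter-injective (suc j) eq = iter-injective j (f-injective eq)

    iter-notFixed-alongOrbit : ∀ {p x} → iter f p x ≢ x → ∀ j → iter f p (iter f j x) ≢ iter f j x
    iter-notFixed-alongOrbit {p} {x} notFixed j eq =
      notFixed (iter-injective j (trans (iter-comm j p x) eq))

∧≡true⇒ : ∀ {a b} → a ∧ b ≡ true → a ≡ true × b ≡ true
∧≡true⇒ {true} eq = refl , eq

module _ {m n : ℕ} where

  ==⇒≡ : ∀ {u v : Vertex m n} → (u == v) ≡ true → u ≡ v
  ==⇒≡ {i , j} {i′ , j′} eq with i ≟ i′ | j ≟ j′ | eq
  ... | yes refl | yes refl | _ = refl
  ... | yes _    | no _     | ()
  ... | no _     | _        | ()

  ==-refl : ∀ (v : Vertex m n) → (v == v) ≡ true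
  ==-refl (i , j) with i ≟ i | j ≟ j
  ... | yes _   | yes _   = refl
  ... | no i≢i  | _       = ⊥-elim (i≢i refl)
  ... | yes _   | no j≢j  = ⊥-elim (j≢j refl)

  not-==⇒≢ : ∀ {u v : Vertex m n} → not (u == v) ≡ true → u ≢ v
  not-==⇒≢ {u} eq refl with subst (λ b → not b ≡ true) (==-refl u) eq
  ... | ()

  module _ (f : Vertex m n → Vertex m n) (v : Vertex m n) (p : ℕ)
           (len : isCycleLength f v (suc p) ≡ true) where

    isCycleLength⇒period : iter f (suc p) v ≡ v
    isCycleLength⇒period = ==⇒≡ (proj₁ (∧≡true⇒ len))

    isCycleLength⇒minimal : All (λ q → iter f (suc q) v ≢ v) (upTo p)
    isCycleLength⇒minimal = All.map not-==⇒≢ (foldr-∧ (upTo p) (proj₂ (∧≡true⇒ len)))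
      where
      foldr-∧ : ∀ qs → foldr (λ q b → not (iter f (suc q) v == v) ∧ b) true qs ≡ true →
                All (λ q → not (iter f (suc q) v == v) ≡ true) qs
      foldr-∧ []       _  = []
      foldr-∧ (q ∷ qs) eq = proj₁ (∧≡true⇒ eq) ∷ foldr-∧ qs (proj₂ (∧≡true⇒ eq))

module _ {m n : ℕ} where

  pt : Vertex m n → Point
  pt (i , j) = toℕ i , toℕ j

  pt-injective : ∀ {u v} → pt u ≡ pt v → u ≡ v
  pt-injective eq = cong₂ _,_ (toℕ-injective (cong proj₁ eq)) (toℕ-injective (cong proj₂ eq))

  Adj⇒LatticeAdj : ∀ {u v} → Adj u v → LatticeAdj (pt u) (pt v)
  Adj⇒LatticeAdj {i , j} {i′ , j′} = ∣-∣+∣-∣≡1⇒LatticeAdj (toℕ i) (toℕ j) (toℕ i′) (toℕ j′)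

∈-injection⇒≤-length : ∀ {A : Set} {k} {xs : List A} (g : Fin k → A) →
                       (∀ i → g i ∈ xs) → Injective _≡_ _≡_ g → k ≤ length xs
∈-injection⇒≤-length {xs = xs} g mem g-injective = injective⇒≤ λ {i} {j} eq → g-injective (begin
  g i                       ≡⟨ lookup-index (mem i) ⟩
  lookup xs (index (mem i)) ≡⟨ cong (lookup xs) eq ⟩
  lookup xs (index (mem j)) ≡⟨ lookup-index (mem j) ⟨
  g j                       ∎)

width<count : ∀ {m n} {P : Vertex m n → Set} (xs : List (Vertex m n)) →
              (∀ {v} → P v → v ∈ xs) → (∀ c → ∃[ i ] P (i , c)) →
              ∀ {b b′} → P b → P b′ → b ≢ b′ → proj₂ b ≡ proj₂ b′ → suc n ≤ length xs
width<count {m} {n} {P} xs complete inEveryColumn {b} {b′} Pb Pb′ b≢b′ sameColumn =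
  ∈-injection⇒≤-length g (complete ∘ P-g) g-injective
  where
  pick : Fin n → Vertex m n
  pick c with c ≟ proj₂ b
  ... | yes _ = b
  ... | no _  = proj₁ (inEveryColumn c) , c

  P-pick : ∀ c → P (pick c) × proj₂ (pick c) ≡ c
  P-pick c with c ≟ proj₂ b
  ... | yes refl = Pb , refl
  ... | no _     = proj₂ (inEveryColumn c) , refl

  pick-b : pick (proj₂ b) ≡ b
  pick-b with proj₂ b ≟ proj₂ b
  ... | yes _   = refl
  ... | no b≢b  = ⊥-elim (b≢b refl)

  g : Fin (suc n) → Vertex m n
  g zero    = b′
  g (suc c) = pick c

  P-g : ∀ i → P (g i)
  P-g zero    = Pb′
  P-g (suc c) = proj₁ (P-pick c)

  b′≢pick : ∀ c → b′ ≢ pick c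
  b′≢pick c eq = b≢b′ (begin
    b              ≡⟨ pick-b ⟨
    pick (proj₂ b) ≡⟨ cong pick (trans sameColumn (trans (cong proj₂ eq) (proj₂ (P-pick c)))) ⟩
    pick c         ≡⟨ eq ⟨
    b′             ∎)

  g-injective : Injective _≡_ _≡_ g
  g-injective {zero}  {zero}   _  = refl
  g-injective {zero}  {suc c}  eq = ⊥-elim (b′≢pick c eq)
  g-injective {suc c} {zero}   eq = ⊥-elim (b′≢pick c (sym eq))
  g-injective {suc c} {suc c′} eq =
    cong suc (trans (sym (proj₂ (P-pick c))) (trans (cong proj₂ eq) (proj₂ (P-pick c′))))

length-vertices : ∀ m n → length (vertices m n) ≡ m * n
length-vertices m n = trans (rows (allFin m)) (cong (_* n) (length-tabulate {n = m} id))
  where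
  rows : ∀ is → length (concatMap (λ i → map (i ,_) (allFin n)) is) ≡ length is * n
  rows []       = refl
  rows (i ∷ is) = trans (length-++ (map (i ,_) (allFin n)))
                        (cong₂ _+_ (trans (length-map _ (allFin n)) (length-tabulate {n = n} id)) (rows is))

∈-vertices : ∀ {m n} (v : Vertex m n) → v ∈ vertices m n
∈-vertices (i , j) = ∈-concat⁺′ (∈-map⁺ _ (∈-allFin j)) (∈-map⁺ _ (∈-allFin i))

module _ {A : Set} {P : A → Set} (P? : Decidable P) where

  length-filter+length-filter-¬ : ∀ xs →
                                  length (filter P? xs) + length (filter (¬? ∘ P?) xs) ≡ length xs
  length-filter+length-filter-¬ []       = refl
  length-filter+length-filter-¬ (x ∷ xs) with P? x
  ... | yes _ = cong suc (length-filter+length-filter-¬ xs)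
  ... | no _  = trans (+-suc _ _) (cong suc (length-filter+length-filter-¬ xs))

  length-filter≢0⇒∃ : ∀ xs → length (filter P? xs) ≢ 0 → ∃[ x ] P x
  length-filter≢0⇒∃ []       empty = ⊥-elim (empty refl)
  length-filter≢0⇒∃ (x ∷ xs) nonempty with P? x
  ... | yes px = x , px
  ... | no _   = length-filter≢0⇒∃ xs nonempty

module _ {m n : ℕ} (f : Vertex m n → Vertex m n) where

  OnFourCycle : Vertex m n → Set
  OnFourCycle v = isCycleLength f v 4 ≡ true

  onFourCycle? : Decidable OnFourCycle
  onFourCycle? v = isCycleLength f v 4 Bool.≟ true

  offFourCycles : List (Vertex m n)
  offFourCycles = filter (¬? ∘ onFourCycle?) (vertices m n)

module _ {m n : ℕ} {f : Vertex m n → Vertex m n} (der : IsGraphDerangement f) where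

  private
    f-injective : Injective _≡_ _≡_ f
    f-injective = proj₁ der

    step : ∀ v → LatticeAdj (pt v) (pt (f v))
    step v = Adj⇒LatticeAdj (proj₂ der v)

  f-noFixedPoint : ∀ v → f v ≢ v
  f-noFixedPoint v eq = LatticeAdj-irrefl (subst (λ w → LatticeAdj (pt v) (pt w)) eq (step v))

  fourCycle-square : ∀ {v} → OnFourCycle f v →
                     Lattice4Cycle (pt v) (pt (f v)) (pt (f (f v))) (pt (f (f (f v))))
  fourCycle-square {v} on = record
    { ab = step v ; bc = step (f v) ; cd = step (f (f v))
    ; da = subst (λ w → LatticeAdj (pt (f (f (f v)))) (pt w)) (isCycleLength⇒period f v 3 on)
                 (step (f (f (f v))))
    ; c≢a = f²v≢v ∘ pt-injective
    ; d≢b = f²v≢v ∘ f-injective ∘ pt-injective }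
    where
    f²v≢v : f (f v) ≢ v
    f²v≢v = All.head (All.tail (isCycleLength⇒minimal f v 3 on))

  columnPartner : Vertex m n → Vertex m n
  columnPartner v with proj₂ (f v) ≟ proj₂ v
  ... | yes _ = f v
  ... | no _  = f (f (f v))

  columnPartner-straight : ∀ {v} → proj₂ (f v) ≡ proj₂ v → columnPartner v ≡ f v
  columnPartner-straight {v} same with proj₂ (f v) ≟ proj₂ v
  ... | yes _    = refl
  ... | no turn  = ⊥-elim (turn same)

  columnPartner-turning : ∀ {v} → proj₂ (f v) ≢ proj₂ v → columnPartner v ≡ f (f (f v))
  columnPartner-turning {v} turn with proj₂ (f v) ≟ proj₂ v
  ... | yes same = ⊥-elim (turn same)
  ... | no _     = refl

  straight⇒next-turns : ∀ {v} → OnFourCycle f v → proj₂ (f v) ≡ proj₂ v →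
                        proj₂ (f (f v)) ≢ proj₂ (f v)
  straight⇒next-turns {v} on same eq = HStep⇒col≢ next (cong toℕ (sym eq))
    where
    next : HStep (pt (f v)) (pt (f (f v)))
    next = VStep⇒HStep-next (fourCycle-square on) (LatticeAdj⇒VStep (step v) (cong toℕ (sym same)))

  turning⇒closing-VStep : ∀ {v} → OnFourCycle f v → proj₂ (f v) ≢ proj₂ v →
                          VStep (pt (f (f (f v)))) (pt v)
  turning⇒closing-VStep {v} on turn =
    HStep⇒VStep-next (rotate (rotate q)) (VStep⇒HStep-next (rotate q) (HStep⇒VStep-next q horizontal))
    where
    q : Lattice4Cycle (pt v) (pt (f v)) (pt (f (f v))) (pt (f (f (f v))))
    q = fourCycle-square on

    horizontal : HStep (pt v) (pt (f v))
    horizontal = LatticeAdj⇒HStep (step v) (turn ∘ sym ∘ toℕ-injective)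

  columnPartner-VStep : ∀ {v} → OnFourCycle f v → VStep (pt v) (pt (columnPartner v))
  columnPartner-VStep {v} on = case proj₂ (f v) ≟ proj₂ v of λ where
    (yes same) → subst (λ w → VStep (pt v) (pt w)) (sym (columnPartner-straight same))
                       (LatticeAdj⇒VStep (step v) (cong toℕ (sym same)))
    (no turn)  → subst (λ w → VStep (pt v) (pt w)) (sym (columnPartner-turning turn))
                       (VStep-sym (turning⇒closing-VStep on turn))

  columnPartner-involutive : ∀ {v} → OnFourCycle f v → columnPartner (columnPartner v) ≡ v
  columnPartner-involutive {v} on = case proj₂ (f v) ≟ proj₂ v of λ where
      (yes same) → begin
        columnPartner (columnPartner v) ≡⟨ cong columnPartner (columnPartner-straight same) ⟩
        columnPartner (f v)             ≡⟨ columnPartner-turning (straight⇒next-turns on same) ⟩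
        f (f (f (f v)))                 ≡⟨ f⁴v≡v ⟩
        v                               ∎
      (no turn) → begin
        columnPartner (columnPartner v) ≡⟨ cong columnPartner (columnPartner-turning turn) ⟩
        columnPartner (f (f (f v)))     ≡⟨ columnPartner-straight (sameColumn turn) ⟩
        f (f (f (f v)))                 ≡⟨ f⁴v≡v ⟩
        v                               ∎
    where
    f⁴v≡v : f (f (f (f v))) ≡ v
    f⁴v≡v = isCycleLength⇒period f v 3 on

    sameColumn : proj₂ (f v) ≢ proj₂ v → proj₂ (f (f (f (f v)))) ≡ proj₂ (f (f (f v)))
    sameColumn turn =
      trans (cong proj₂ f⁴v≡v) (sym (toℕ-injective (proj₁ (turning⇒closing-VStep on turn))))

  -- The column partners would match the rows of a column of odd height.
  oddColumn-meets-offFourCycle : ¬ 2 ∣ m → ∀ c → ∃[ i ] ¬ OnFourCycle f (i , c)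
  oddColumn-meets-offFourCycle odd c =
    ¬∀⟶∃¬ m (λ i → OnFourCycle f (i , c)) (λ i → onFourCycle? f (i , c)) allOnFourCycles⇒⊥
    where
    allOnFourCycles⇒⊥ : (∀ i → OnFourCycle f (i , c)) → ⊥
    allOnFourCycles⇒⊥ on = oddPath-noPerfectMatching odd h apart involutive
      where
      h : Fin m → Fin m
      h i = proj₁ (columnPartner (i , c))

      partner≡ : ∀ i → (h i , c) ≡ columnPartner (i , c)
      partner≡ i = cong (h i ,_) (toℕ-injective (proj₁ (columnPartner-VStep (on i))))

      apart : ∀ i → OneApart (toℕ (h i)) (toℕ i)
      apart i = OneApart-sym (proj₂ (columnPartner-VStep (on i)))

      involutive : ∀ i → h (h i) ≡ i
      involutive i =
        cong proj₁ (trans (cong columnPartner (partner≡ i)) (columnPartner-involutive (on i)))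

  -- Were every step horizontal, the cycle would stay in one row and its columns would
  -- form a non-backtracking walk on ℕ, which never returns.
  longCycle-hasVerticalStep : ∀ {p v} → iter f (suc p) v ≡ v → iter f 2 v ≢ v →
                              ∃[ j ] proj₂ (f (iter f j v)) ≡ proj₂ (iter f j v)
  longCycle-hasVerticalStep {p} {v} period f²v≢v
    with any? (λ (j : Fin (suc p)) → proj₂ (f (iter f (toℕ j) v)) ≟ proj₂ (iter f (toℕ j) v))
  ... | yes (j , vertical) = toℕ j , vertical
  ... | no noneVertical    = ⊥-elim
    (NonBacktrackingWalk.noReturn column (proj₂ ∘ horizontal) noBacktrack p (cong (toℕ ∘ proj₂) period))
    where
    column : ℕ → ℕ
    column j = toℕ (proj₂ (iter f j v))

    horizontal : ∀ j → HStep (pt (iter f j v)) (pt (f (iter f j v)))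
    horizontal j = LatticeAdj⇒HStep (step _) λ eq → noneVertical
      (j mod suc p , subst (λ w → proj₂ (f w) ≡ proj₂ w) (iter-mod f period j) (sym (toℕ-injective eq)))

    row≡ : ∀ j → toℕ (proj₁ (iter f j v)) ≡ toℕ (proj₁ v)
    row≡ zero    = refl
    row≡ (suc j) = trans (sym (proj₁ (horizontal j))) (row≡ j)

    noBacktrack : ∀ j → column (suc (suc j)) ≢ column j
    noBacktrack j eq = iter-notFixed-alongOrbit f f-injective {2} f²v≢v j
      (pt-injective (cong₂ _,_ (trans (row≡ (suc (suc j))) (sym (row≡ j))) eq))

  -- A vertical step of the hexagon puts two vertices off the 4-cycles into one column,
  -- while every other column contains one as well.
  noHexagon : ¬ 2 ∣ m → length (offFourCycles f) ≤ n → ∀ v → isCycleLength f v 6 ≢ true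
  noHexagon odd few v hexagon = 1+n≰n (≤-trans crowded few)
    where
    f²v≢v×f⁴v≢v : iter f 2 v ≢ v × iter f 4 v ≢ v
    f²v≢v×f⁴v≢v with isCycleLength⇒minimal f v 5 hexagon
    ... | _ ∷ f²v≢v ∷ _ ∷ f⁴v≢v ∷ _ = f²v≢v , f⁴v≢v

    off : ∀ i → ¬ OnFourCycle f (iter f i v)
    off i on = iter-notFixed-alongOrbit f f-injective {4} (proj₂ f²v≢v×f⁴v≢v) i
                 (isCycleLength⇒period f (iter f i v) 3 on)

    vertical : ∃[ j ] proj₂ (f (iter f j v)) ≡ proj₂ (iter f j v)
    vertical = longCycle-hasVerticalStep {p = 5} (isCycleLength⇒period f v 5 hexagon) (proj₁ f²v≢v×f⁴v≢v)

    j : ℕ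
    j = proj₁ vertical

    crowded : suc n ≤ length (offFourCycles f)
    crowded = width<count (offFourCycles f) (λ {w} → ∈-filter⁺ _ (∈-vertices w))
                (oddColumn-meets-offFourCycle odd) (off j) (off (suc j))
                (f-noFixedPoint _ ∘ sym) (sym (proj₂ vertical))

mult-replicate : ∀ ℓ N → mult ℓ (replicate N ℓ) ≡ N
mult-replicate ℓ zero    = refl
mult-replicate ℓ (suc N) with ℓ ≡ᵇ ℓ | ≡⇒≡ᵇ ℓ ℓ refl
... | true | _ = cong suc (mult-replicate ℓ N)

sum-replicate : ∀ N x → sum (replicate N x) ≡ N * x
sum-replicate zero    x = refl
sum-replicate (suc N) x = cong (x +_) (sum-replicate N x)

module _ {m n : ℕ} (f : Vertex m n → Vertex m n) (N : ℕ)
         (type : HasCycleType f (6 ∷ replicate N 4)) where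

  length-offFourCycles : 4 * N + 6 ≡ m * n → length (offFourCycles f) ≡ 6
  length-offFourCycles size = +-cancelˡ-≡ (4 * N) _ _ (begin
    4 * N + length off                        ≡⟨ cong (_+ length off) onFourCycles ⟨
    verticesOnCyclesOfLength f 4 + length off ≡⟨ length-filter+length-filter-¬ (onFourCycle? f) (vertices m n) ⟩
    length (vertices m n)                     ≡⟨ length-vertices m n ⟩
    m * n                                     ≡⟨ size ⟨
    4 * N + 6                                 ∎)
    where
    off : List (Vertex m n)
    off = offFourCycles f

    onFourCycles : verticesOnCyclesOfLength f 4 ≡ 4 * N
    onFourCycles = trans (type 4) (cong (4 *_) (mult-replicate 4 N))

  hexagon-exists : ∃[ v ] isCycleLength f v 6 ≡ true
  hexagon-exists = length-filter≢0⇒∃ (λ v → isCycleLength f v 6 Bool.≟ true) (vertices m n)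
                     λ none → case trans (sym none) (type 6) of λ ()

4*[m*n∸6]/4+6≡m*n : ∀ {m} → ¬ 2 ∣ m → ∀ k →
                    4 * ((m * (4 * suc k + 2) ∸ 6) / 4) + 6 ≡ m * (4 * suc k + 2)
4*[m*n∸6]/4+6≡m*n odd k with odd⇒≡1+2* odd
... | t , refl = begin
  4 * ((mn ∸ 6) / 4) + 6        ≡⟨ cong (λ x → 4 * ((x ∸ 6) / 4) + 6) (expand t k) ⟩
  4 * ((4 * q + 6 ∸ 6) / 4) + 6 ≡⟨ cong (λ x → 4 * (x / 4) + 6) (m+n∸n≡m (4 * q) 6) ⟩
  4 * (4 * q / 4) + 6           ≡⟨ cong (λ x → 4 * (x / 4) + 6) (*-comm 4 q) ⟩
  4 * (q * 4 / 4) + 6           ≡⟨ cong (λ x → 4 * x + 6) (m*n/n≡m q 4) ⟩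
  4 * q + 6                     ≡⟨ expand t k ⟨
  mn                            ∎
  where
  mn q : ℕ
  mn = suc (2 * t) * (4 * suc k + 2)
  q = k + t + 2 * t * suc k

  expand : ∀ t k → suc (2 * t) * (4 * suc k + 2) ≡ 4 * (k + t + 2 * t * suc k) + 6
  expand = solve-∀

proposition22 : (m k : ℕ) → ¬ (2 ∣ m) →
    (¬ Σ (Vertex m (4 * suc k + 2) → Vertex m (4 * suc k + 2))
         (λ f → IsGraphDerangement f ×
                HasCycleType f (6 ∷ replicate ((m * (4 * suc k + 2) ∸ 6) / 4) 4)))
    × ¬ EvenUniversal m (4 * suc k + 2)
proposition22 m k odd = noDerangement , noDerangement ∘ universal⇒derangement
  where
  n N : ℕ
  n = 4 * suc k + 2
  N = (m * n ∸ 6) / 4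

  size : 4 * N + 6 ≡ m * n
  size = 4*[m*n∸6]/4+6≡m*n odd k

  Derangement : Set
  Derangement = Σ (Vertex m n → Vertex m n) (λ f → IsGraphDerangement f × HasCycleType f (6 ∷ replicate N 4))

  noDerangement : ¬ Derangement
  noDerangement (f , der , type) = noHexagon der odd few (proj₁ hexagon) (proj₂ hexagon)
    where
    hexagon : ∃[ v ] isCycleLength f v 6 ≡ true
    hexagon = hexagon-exists f N type

    few : length (offFourCycles f) ≤ n
    few = subst (_≤ n) (sym (length-offFourCycles f N type size)) (+-monoˡ-≤ 2 (*-monoʳ-≤ 4 (s≤s z≤n)))

  universal⇒derangement : EvenUniversal m n → Derangement
  universal⇒derangement universal = universal (6 ∷ replicate N 4)
    ((s≤s z≤n , divides 3 refl) ∷ replicate⁺ N (s≤s z≤n , divides 2 refl))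
    (begin
      6 + sum (replicate N 4) ≡⟨ cong (6 +_) (sum-replicate N 4) ⟩
      6 + N * 4               ≡⟨ +-comm 6 (N * 4) ⟩
      N * 4 + 6               ≡⟨ cong (_+ 6) (*-comm N 4) ⟩
      4 * N + 6               ≡⟨ size ⟩
      m * n                   ∎)
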